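{- The quotient algebra $\mathfrak{Fm}_i/\!\equiv_i$ is an $iH^{\triangle}_3$-algebra with operations $|\alpha|\to|\beta|=|\alpha\to\beta|$, $|\alpha|\wedge|\beta|=|\alpha\wedge\beta|$, $\triangle|\alpha|=|\triangle\alpha|$, and top element $1=|\beta\to\beta|=\{\alpha\in\mathfrak{Fm}_i:\vdash_i\alpha\}$, where $|\delta|$ denotes the equivalence class of $\delta$. Moreover, $|\alpha|\le|\beta|$ if and only if $\vdash_i\alpha\to\beta$.
   Context: $\mathfrak{Fm}_i$ is the absolutely free algebra of formulas over a countable set of propositional variables in signature $\{\to,\wedge,\triangle\}$. The calculus $i\mathcal{H}^3_\triangle$ has axiom schemas (A1) $\alpha\to(\beta\to\alpha)$; (A2) $(\alpha\to(\beta\to\gamma))\to((\alpha\to\beta)\to(\alpha\to\gamma))$; (A3) $((\alpha\to\beta)\to\gamma)\to(((\gamma\to\alpha)\to\gamma)\to\gamma)$; (A4) $(\alpha\wedge\beta)\to\beta$; (A5) $(\alpha\wedge\beta)\to\alpha$; (A6) $\alpha\to(\beta\to(\alpha\wedge\beta))$; (A7) $\triangle\alpha\to\alpha$; (A8) $\triangle(\triangle\alpha\to\beta)\to(\triangle\alpha\to\triangle\beta)$; (A9) $((\beta\to\triangle\beta)\to(\alpha\to\triangle(\alpha\to\beta)))\to\triangle(\alpha\to\beta)$; (A10) $((\triangle\alpha\to\beta)\to\gamma)\to((\triangle\alpha\to\gamma)\to\gamma)$; rules: modus ponens, necessitation (from $\alpha$ infer $\triangle\alpha$), and from $\alpha\to\beta$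 infer $\alpha\to(\alpha\wedge\beta)$. $\vdash_i$ denotes derivability. $\alpha\equiv_i\beta$ iff $\vdash_i\alpha\to\beta$ and $\vdash_i\beta\to\alpha$; this is a congruence on $\mathfrak{Fm}_i$. In the quotient, $|\alpha|\le|\beta|$ denotes $|\alpha|\to|\beta|=1$. An $iH^{\triangle}_3$-algebra is $(A,\to,\wedge,\triangle,1)$ such that $x\to(y\to x)=1$, $(x\to(y\to z))\to((x\to y)\to(x\to z))=1$, ($x\to y=1=y\to x$ implies $x=y$), $((x\to y)\to z)\to(((z\to x)\to z)\to z)=1$, $x\wedge(y\wedge z)=(x\wedge y)\wedge z$, $x\wedge x=x$, $x\wedge(x\to y)=x\wedge y$, $(x\to(y\wedge z))\to((x\to z)\wedge(x\to y))=1$, $\triangle x\to x=1$, $((y\to\triangle y)\to(x\to\triangle\triangle x))\to\triangle(x\to y)=\triangle x\to\triangle\triangle y$, and $(\triangle x\to\triangle y)\to\triangle x=\triangle x$. -}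

module Defs where

open import Data.Nat using (ℕ)
open import Data.Product using (_×_)
open import Function.Bundles using (_⇔_)
open import Relation.Binary.Structures using (IsEquivalence)
open import Level using (Level; _⊔_; suc)

infixr 5 _⇒_
infixr 6 _∧_

data Fm : Set where
  var : ℕ → Fm
  _⇒_ : Fm → Fm → Fm
  _∧_ : Fm → Fm → Fm
  △   : Fm → Fm

data ⊢_ : Fm → Set where
  A1  : ∀ α β → ⊢ (α ⇒ (β ⇒ α))
  A2  : ∀ α β γ → ⊢ ((α ⇒ (β ⇒ γ)) ⇒ ((α ⇒ β) ⇒ (α ⇒ γ)))
  A3  : ∀ α β γ → ⊢ (((α ⇒ β) ⇒ γ) ⇒ (((γ ⇒ α) ⇒ γ) ⇒ γ))
  A4  : ∀ α β → ⊢ ((α ∧ β) ⇒ β)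
  A5  : ∀ α β → ⊢ ((α ∧ β) ⇒ α)
  A6  : ∀ α β → ⊢ (α ⇒ (β ⇒ (α ∧ β)))
  A7  : ∀ α → ⊢ (△ α ⇒ α)
  A8  : ∀ α β → ⊢ (△ (△ α ⇒ β) ⇒ (△ α ⇒ △ β))
  A9  : ∀ α β → ⊢ (((β ⇒ △ β) ⇒ (α ⇒ △ (α ⇒ β))) ⇒ △ (α ⇒ β))
  A10 : ∀ α β γ → ⊢ (((△ α ⇒ β) ⇒ γ) ⇒ ((△ α ⇒ γ) ⇒ γ))
  MP  : ∀ {α β} → ⊢ α → ⊢ (α ⇒ β) → ⊢ β
  NEC : ∀ {α} → ⊢ α → ⊢ (△ α)
  CONJ : ∀ {α β} → ⊢ (α ⇒ β) → ⊢ (α ⇒ (α ∧ β))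

_≡ᵢ_ : Fm → Fm → Set
α ≡ᵢ β = (⊢ (α ⇒ β)) × (⊢ (β ⇒ α))

-- An iH^△_3-algebra presented on a carrier with an equivalence relation _≈_
-- (standing in for equality); the operations must respect _≈_, so the
-- quotient by _≈_ is an iH^△_3-algebra in the usual sense.
record IsIH3△Algebra {a ℓ} {A : Set a} (_≈_ : A → A → Set ℓ)
       (_⟶_ : A → A → A) (_⊓_ : A → A → A) (Δ : A → A) (𝟙 : A) : Set (a ⊔ ℓ) where
  field
    isEquivalence : IsEquivalence _≈_
    ⟶-cong : ∀ {x x′ y y′} → x ≈ x′ → y ≈ y′ → (x ⟶ y) ≈ (x′ ⟶ y′)
    ⊓-cong : ∀ {x x′ y y′} → x ≈ x′ → y ≈ y′ → (x ⊓ y) ≈ (x′ ⊓ y′)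
    Δ-cong : ∀ {x x′} → x ≈ x′ → Δ x ≈ Δ x′
    ax1  : ∀ x y → (x ⟶ (y ⟶ x)) ≈ 𝟙
    ax2  : ∀ x y z → ((x ⟶ (y ⟶ z)) ⟶ ((x ⟶ y) ⟶ (x ⟶ z))) ≈ 𝟙
    ax3  : ∀ x y → (x ⟶ y) ≈ 𝟙 → (y ⟶ x) ≈ 𝟙 → x ≈ y
    ax4  : ∀ x y z → (((x ⟶ y) ⟶ z) ⟶ (((z ⟶ x) ⟶ z) ⟶ z)) ≈ 𝟙
    ax5  : ∀ x y z → (x ⊓ (y ⊓ z)) ≈ ((x ⊓ y) ⊓ z)
    ax6  : ∀ x → (x ⊓ x) ≈ x
    ax7  : ∀ x y → (x ⊓ (x ⟶ y)) ≈ (x ⊓ y)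
    ax8  : ∀ x y z → ((x ⟶ (y ⊓ z)) ⟶ ((x ⟶ z) ⊓ (x ⟶ y))) ≈ 𝟙
    ax9  : ∀ x → (Δ x ⟶ x) ≈ 𝟙
    ax10 : ∀ x y → (((y ⟶ Δ y) ⟶ (x ⟶ Δ (Δ x))) ⟶ Δ (x ⟶ y)) ≈ (Δ x ⟶ Δ (Δ y))
    ax11 : ∀ x y → ((Δ x ⟶ Δ y) ⟶ Δ x) ≈ Δ x

𝟙ᵢ : Fm
𝟙ᵢ = var 0 ⇒ var 0

_≤ᵢ_ : Fm → Fm → Set
α ≤ᵢ β = (α ⇒ β) ≡ᵢ 𝟙ᵢ

-- A1 and A2 give the deduction theorem, so derivations can be written as
-- λ-terms over hypotheses; with A4–A6 for ∧ this proves every law of the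
-- implication–conjunction fragment needed, and necessitation with A7–A10 yields
-- monotonicity of △, K and 4, from which the △-equations follow.  The theorems
-- form a single ≡ᵢ-class: any two are interderivable by A1.
module Submission where

open import Data.List using (List; []; _∷_)
open import Data.List.Membership.Propositional using (_∈_)
open import Data.List.Relation.Unary.Any using (here; there)
open import Data.Product using (_×_; _,_)
open import Function.Bundles using (_⇔_; mk⇔)
open import Relation.Binary.PropositionalEquality using (refl)
open import Relation.Binary.Structures using (IsEquivalence)

open import Defs

infix 3 _⊩_

data _⊩_ (Γ : List Fm) : Fm → Set where
  hyp : ∀ {α} → α ∈ Γ → Γ ⊩ α
  thm : ∀ {α} → ⊢ α → Γ ⊩ α
  app : ∀ {α β} → Γ ⊩ (α ⇒ β) → Γ ⊩ α → Γ ⊩ β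

#0 : ∀ {Γ α} → α ∷ Γ ⊩ α
#0 = hyp (here refl)

#1 : ∀ {Γ α β} → β ∷ α ∷ Γ ⊩ α
#1 = hyp (there (here refl))

#2 : ∀ {Γ α β γ} → γ ∷ β ∷ α ∷ Γ ⊩ α
#2 = hyp (there (there (here refl)))

#3 : ∀ {Γ α β γ δ} → δ ∷ γ ∷ β ∷ α ∷ Γ ⊩ α
#3 = hyp (there (there (there (here refl))))

⊢-id : ∀ α → ⊢ (α ⇒ α)
⊢-id α = MP (A1 α α) (MP (A1 α (α ⇒ α)) (A2 α (α ⇒ α) α))

deduction : ∀ {Γ α β} → α ∷ Γ ⊩ β → Γ ⊩ (α ⇒ β)
deduction {α = α}     (hyp (here refl))   = thm (⊢-id α)
deduction {α = α} {β} (hyp (there β∈Γ))   = app (thm (A1 β α)) (hyp β∈Γ)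
deduction {α = α} {β} (thm ⊢β)            = thm (MP ⊢β (A1 β α))
deduction {α = α} {β} (app {γ} f x)       =
  app (app (thm (A2 α γ β)) (deduction f)) (deduction x)

closed : ∀ {α} → [] ⊩ α → ⊢ α
closed (thm ⊢α)  = ⊢α
closed (app f x) = MP (closed x) (closed f)

⊢λ : ∀ {α β} → α ∷ [] ⊩ β → ⊢ (α ⇒ β)
⊢λ d = closed (deduction d)

⊢λλ : ∀ {α β γ} → β ∷ α ∷ [] ⊩ γ → ⊢ (α ⇒ β ⇒ γ)
⊢λλ d = closed (deduction (deduction d))

pair : ∀ {Γ α β} → Γ ⊩ α → Γ ⊩ β → Γ ⊩ (α ∧ β)
pair {α = α} {β} p q = app (app (thm (A6 α β)) p) q

fst : ∀ {Γ α β} → Γ ⊩ (α ∧ β) → Γ ⊩ α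
fst {α = α} {β} p = app (thm (A5 α β)) p

snd : ∀ {Γ α β} → Γ ⊩ (α ∧ β) → Γ ⊩ β
snd {α = α} {β} p = app (thm (A4 α β)) p

⊢-trans : ∀ {α β γ} → ⊢ (α ⇒ β) → ⊢ (β ⇒ γ) → ⊢ (α ⇒ γ)
⊢-trans f g = ⊢λ (app (thm g) (app (thm f) #0))

⊢-⇒-mono : ∀ {α α′ β β′} → ⊢ (α′ ⇒ α) → ⊢ (β ⇒ β′) → ⊢ ((α ⇒ β) ⇒ (α′ ⇒ β′))
⊢-⇒-mono f g = ⊢λλ (app (thm g) (app #1 (app (thm f) #0)))

⊢-∧-mono : ∀ {α α′ β β′} → ⊢ (α ⇒ α′) → ⊢ (β ⇒ β′) → ⊢ ((α ∧ β) ⇒ (α′ ∧ β′))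
⊢-∧-mono f g = ⊢λ (pair (app (thm f) (fst #0)) (app (thm g) (snd #0)))

△-mono : ∀ {α β} → ⊢ (α ⇒ β) → ⊢ (△ α ⇒ △ β)
△-mono {α} {β} f = MP (NEC (⊢λ (app (thm f) (app (thm (A7 α)) #0)))) (A8 α β)

△-four : ∀ α → ⊢ (△ α ⇒ △ (△ α))
△-four α = MP (NEC (⊢-id (△ α))) (A8 α (△ α))

△-K : ∀ α β → ⊢ (△ (α ⇒ β) ⇒ (△ α ⇒ △ β))
△-K α β = ⊢λλ (app (app (thm (A8 α β)) (app (thm (△-mono weaken)) #1)) #0)
  where
  weaken : ⊢ ((α ⇒ β) ⇒ (△ α ⇒ β))
  weaken = ⊢λλ (app #1 (app (thm (A7 α)) #0))

≡ᵢ-isEquivalence : IsEquivalence _≡ᵢ_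
≡ᵢ-isEquivalence = record
  { refl  = λ {α} → ⊢-id α , ⊢-id α
  ; sym   = λ (f , g) → g , f
  ; trans = λ (f , g) (f′ , g′) → ⊢-trans f f′ , ⊢-trans g′ g
  }

⊢⇒≡ᵢ𝟙ᵢ : ∀ {α} → ⊢ α → α ≡ᵢ 𝟙ᵢ
⊢⇒≡ᵢ𝟙ᵢ {α} ⊢α = MP (⊢-id (var 0)) (A1 𝟙ᵢ α) , MP ⊢α (A1 α 𝟙ᵢ)

≡ᵢ𝟙ᵢ⇒⊢ : ∀ {α} → α ≡ᵢ 𝟙ᵢ → ⊢ α
≡ᵢ𝟙ᵢ⇒⊢ (_ , g) = MP (⊢-id (var 0)) g

∧-assoc : ∀ α β γ → (α ∧ (β ∧ γ)) ≡ᵢ ((α ∧ β) ∧ γ)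
∧-assoc _ _ _ = ⊢λ (pair (pair (fst #0) (fst (snd #0))) (snd (snd #0)))
              , ⊢λ (pair (fst (fst #0)) (pair (snd (fst #0)) (snd #0)))

∧-idem : ∀ α → (α ∧ α) ≡ᵢ α
∧-idem _ = ⊢λ (fst #0) , ⊢λ (pair #0 #0)

∧-⇒-absorb : ∀ α β → (α ∧ (α ⇒ β)) ≡ᵢ (α ∧ β)
∧-⇒-absorb α β = ⊢λ (pair (fst #0) (app (snd #0) (fst #0)))
               , ⊢λ (pair (fst #0) (app (thm (A1 β α)) (snd #0)))

⇒-∧-split : ∀ α β γ → ⊢ ((α ⇒ (β ∧ γ)) ⇒ ((α ⇒ γ) ∧ (α ⇒ β)))
⇒-∧-split _ _ _ = ⊢λ (pair (deduction (snd (app #1 #0))) (deduction (fst (app #1 #0))))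

△-A9-premise≡ᵢ△⇒△△ : ∀ α β →
  (((β ⇒ △ β) ⇒ (α ⇒ △ (△ α))) ⇒ △ (α ⇒ β)) ≡ᵢ (△ α ⇒ △ (△ β))
△-A9-premise≡ᵢ△⇒△△ α β = ⊢λλ to , ⊢λλ (app (thm (A9 α β)) (deduction (deduction from)))
  where
  to : △ α ∷ (((β ⇒ △ β) ⇒ (α ⇒ △ (△ α))) ⇒ △ (α ⇒ β)) ∷ [] ⊩ △ (△ β)
  to = app (thm (△-four β))
         (app (app (thm (△-K α β)) (app #1 (deduction (deduction (app (thm (△-four α)) #2))))) #0)

  from : α ∷ (β ⇒ △ β) ∷ ((β ⇒ △ β) ⇒ (α ⇒ △ (△ α))) ∷ (△ α ⇒ △ (△ β)) ∷ [] ⊩ △ (α ⇒ β)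
  from = app (thm (△-mono (A1 β α)))
           (app (thm (A7 (△ β))) (app #3 (app (thm (A7 (△ α))) (app (app #2 #1) #0))))

△-peirce : ∀ α β → ((△ α ⇒ △ β) ⇒ △ α) ≡ᵢ △ α
△-peirce α β = ⊢λ (app (app (thm (A10 α (△ β) (△ α))) #0) (thm (⊢-id (△ α))))
             , A1 (△ α) (△ α ⇒ △ β)

Fm/≡ᵢ-isIH3△Algebra : IsIH3△Algebra _≡ᵢ_ _⇒_ _∧_ △ 𝟙ᵢ
Fm/≡ᵢ-isIH3△Algebra = record
  { isEquivalence = ≡ᵢ-isEquivalence
  ; ⟶-cong = λ (f , g) (f′ , g′) → ⊢-⇒-mono g f′ , ⊢-⇒-mono f g′
  ; ⊓-cong = λ (f , g) (f′ , g′) → ⊢-∧-mono f f′ , ⊢-∧-mono g g′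
  ; Δ-cong = λ (f , g) → △-mono f , △-mono g
  ; ax1  = λ α β → ⊢⇒≡ᵢ𝟙ᵢ (A1 α β)
  ; ax2  = λ α β γ → ⊢⇒≡ᵢ𝟙ᵢ (A2 α β γ)
  ; ax3  = λ _ _ f g → ≡ᵢ𝟙ᵢ⇒⊢ f , ≡ᵢ𝟙ᵢ⇒⊢ g
  ; ax4  = λ α β γ → ⊢⇒≡ᵢ𝟙ᵢ (A3 α β γ)
  ; ax5  = ∧-assoc
  ; ax6  = ∧-idem
  ; ax7  = ∧-⇒-absorb
  ; ax8  = λ α β γ → ⊢⇒≡ᵢ𝟙ᵢ (⇒-∧-split α β γ)
  ; ax9  = λ α → ⊢⇒≡ᵢ𝟙ᵢ (A7 α)
  ; ax10 = △-A9-premise≡ᵢ△⇒△△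
  ; ax11 = △-peirce
  }

mainTheorem11 : IsIH3△Algebra _≡ᵢ_ _⇒_ _∧_ △ 𝟙ᵢ
                  × (∀ β → (β ⇒ β) ≡ᵢ 𝟙ᵢ)
                  × (∀ α → (α ≡ᵢ 𝟙ᵢ) ⇔ (⊢ α))
                  × (∀ α β → (α ≤ᵢ β) ⇔ (⊢ (α ⇒ β)))
mainTheorem11 = Fm/≡ᵢ-isIH3△Algebra
              , (λ β → ⊢⇒≡ᵢ𝟙ᵢ (⊢-id β))
              , (λ _ → mk⇔ ≡ᵢ𝟙ᵢ⇒⊢ ⊢⇒≡ᵢ𝟙ᵢ)
              , (λ _ _ → mk⇔ ≡ᵢ𝟙ᵢ⇒⊢ ⊢⇒≡ᵢ𝟙ᵢ)
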